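{- Let $G$ be a connected graph of order $n\ge 2$ with $V(G)=\{u_1,\ldots,u_n\}$ and let $\mathcal{H}=\{H_1,\ldots,H_n\}$ be a family of $n$ non-trivial graphs. The graph $G\circ\mathcal{H}$ is $k$-metric dimensional if and only if $k=\min\{\mathcal{T}(G\circ\mathcal{H}),\mathcal{C}(\mathcal{H})\}$.
   Context: All graphs are finite and simple; a graph is non-trivial if it has at least two vertices. $N_H(x)$ is the open and $N_H[x]=N_H(x)\cup\{x\}$ the closed neighborhood; $\delta(H)$ and $\Delta(H)$ are the minimum and maximum degree; $d_G$ is the shortest-path distance. The lexicographic product $G\circ\mathcal{H}$ has vertex set $\bigcup_{i=1}^n\{u_i\}\times V(H_i)$, and $(u_i,v)$ is adjacent to $(u_j,w)$ iff $u_iu_j\in E(G)$, or $i=j$ and $vw\in E(H_i)$. For a connected graph $X$ and positive integer $k$, a set $S\subseteq V(X)$ is a $k$-metric generator if every two distinct vertices $x,y$ admit at least $k$ vertices $w\in S$ with $d_X(x,w)\neq d_X(y,w)$; $X$ is $k$-metric dimensional if $k$ is the largest integer for which a $k$-metric generator of $X$ exists. For a graph $H$ and distinct $x,y\in V(H)$, $\mathcal{C}_H(x,y)=(N_H(x)\triangledown N_H(y))\cup\{x,y\}$ ($\triangledown$ = symmetric difference), $\mathcal{C}(H)=\min_{x\neq y}|\mathcal{C}_H(x,y)|$, and $\mathcal{C}(\mathcal{H})=\min_i\mathcal{C}(H_i)$. Distinct vertices $x,y$ of $G$ are true twins if $N_G[x]=N_G[y]$ and false twins if $N_G(x)=N_G(y)$.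 The relation $x\mathcal{R}y\iff N_G(x)-\{y\}=N_G(y)-\{x\}$ is an equivalence relation whose classes are singletons, false twin classes (any two members are false twins) or true twin classes (any two members are true twins). $S(G)$, $FT(G)$, $TT(G)$ denote the unions of the singleton, false twin and true twin classes; for $u_i\in FT(G)$ (resp. $TT(G)$) $FT(u_i)$ (resp. $TT(u_i)$) denotes its class. Define $\mathcal{T}(u_i,\mathcal{H})=|V(H_i)|$ if $u_i\in S(G)$; $\mathcal{T}(u_i,\mathcal{H})=\min\{\delta(H_j)+\delta(H_l)+2: u_j,u_l\in FT(u_i), j\neq l\}$ if $u_i\in FT(G)$; $\mathcal{T}(u_i,\mathcal{H})=\min\{|V(H_j)|-\Delta(H_j)+|V(H_l)|-\Delta(H_l): u_j,u_l\in TT(u_i), j\neq l\}$ if $u_i\in TT(G)$; and $\mathcal{T}(G\circ\mathcal{H})=\min_{u_i\in V(G)}\mathcal{T}(u_i,\mathcal{H})$. -}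

module Defs where

open import Data.Nat using (ℕ; zero; suc; _+_; _∸_; _≤_; _<_; _⊓_; _⊔_)
open import Data.Bool using (Bool; true; false; _∧_; _∨_; not; if_then_else_; _xor_)
open import Data.Fin using (Fin; _≟_)
open import Data.List using (List; []; _∷_; foldr; map; length; filter; allFin; concatMap)
open import Data.List.Relation.Unary.All using (All)
open import Data.List.Relation.Unary.Unique.Propositional using (Unique)
open import Data.Product using (Σ; _×_; _,_; ∃)
open import Relation.Binary.PropositionalEquality using (_≡_; _≢_)
open import Relation.Nullary using (¬_; does)

record Graph : Set where
  field
    order : ℕ
    adj   : Fin order → Fin order → Bool
    sym   : ∀ x y → adj x y ≡ adj y x
    irrefl : ∀ x → adj x x ≡ false
open Graph public

module Metric {V : Set} (Adj : V → V → Set) where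

  data Walk : V → V → ℕ → Set where
    here : ∀ {x} → Walk x x 0
    step : ∀ {x y z k} → Adj x y → Walk y z k → Walk x z (suc k)

  Connected : Set
  Connected = ∀ x y → ∃ λ k → Walk x y k

  IsDist : V → V → ℕ → Set
  IsDist x y d = Walk x y d × (∀ k → Walk x y k → d ≤ k)

  Distinguishes : V → V → V → Set
  Distinguishes w x y = ∀ d₁ d₂ → IsDist x w d₁ → IsDist y w d₂ → d₁ ≢ d₂

  IsKMetricGenerator : (V → Set) → ℕ → Set
  IsKMetricGenerator S k =
    ∀ x y → x ≢ y →
      Σ (List V) λ ws → (k ≤ length ws) × Unique ws × All S ws
                        × All (λ w → Distinguishes w x y) ws

  KMetricDimensional : ℕ → Set₁
  KMetricDimensional k =
    (1 ≤ k) × (Σ (V → Set) λ S → IsKMetricGenerator S k)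
    × (∀ k′ → k < k′ → ¬ (Σ (V → Set) λ S → IsKMetricGenerator S k′))

LexVertex : (G : Graph) → (Fin (order G) → Graph) → Set
LexVertex G H = Σ (Fin (order G)) λ i → Fin (order (H i))

data LexAdj (G : Graph) (H : Fin (order G) → Graph) : LexVertex G H → LexVertex G H → Set where
  outer : ∀ {i j v w} → adj G i j ≡ true → LexAdj G H (i , v) (j , w)
  inner : ∀ {i v w} → adj (H i) v w ≡ true → LexAdj G H (i , v) (i , w)

-- minimum of a list, with 0 for the empty list (never used on empty lists
-- in the theorem below)
minList : List ℕ → ℕ
minList [] = 0
minList (x ∷ xs) = foldr _⊓_ x xs

maxList : List ℕ → ℕ
maxList [] = 0
maxList (x ∷ xs) = foldr _⊔_ x xs

countB : ∀ {n} → (Fin n → Bool) → ℕ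
countB {n} p = length (filter (λ z → p z Data.Bool.≟ true) (allFin n))

eqB : ∀ {n} → Fin n → Fin n → Bool
eqB x y = does (x ≟ y)

distinctPairs : ∀ {n} → (Fin n → Fin n → Bool) → List (Fin n × Fin n)
distinctPairs {n} p =
  concatMap (λ x → map (λ y → (x , y))
    (filter (λ y → (not (eqB x y) ∧ p x y) Data.Bool.≟ true) (allFin n)))
    (allFin n)

degree : (H : Graph) → Fin (order H) → ℕ
degree H x = countB (adj H x)

δ : Graph → ℕ
δ H = minList (map (degree H) (allFin (order H)))

Δ : Graph → ℕ
Δ H = maxList (map (degree H) (allFin (order H)))

𝒞pair : (H : Graph) → Fin (order H) → Fin (order H) → ℕ
𝒞pair H x y = countB (λ z → eqB z x ∨ eqB z y ∨ (adj H x z xor adj H y z))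

𝒞 : Graph → ℕ
𝒞 H = minList (map (λ { (x , y) → 𝒞pair H x y }) (distinctPairs (λ _ _ → true)))

𝒞fam : (G : Graph) → (Fin (order G) → Graph) → ℕ
𝒞fam G H = minList (map (λ i → 𝒞 (H i)) (allFin (order G)))

-- Twin relation  x 𝓡 y  ⇔  N(x) - {y} = N(y) - {x}
-- (for z ∉ {x,y}: z ∈ N(x) ⇔ z ∈ N(y); x,y themselves never lie in
--  either side, since the graph is loopless)

twinRel : (G : Graph) → Fin (order G) → Fin (order G) → Bool
twinRel G x y =
  foldr _∧_ true
    (map (λ z → (eqB z x ∨ eqB z y) ∨ not (adj G x z xor adj G y z))
         (allFin (order G)))

isSingleton : (G : Graph) → Fin (order G) → Bool
isSingleton G i = foldr _∧_ true
  (map (λ j → eqB j i ∨ not (twinRel G i j)) (allFin (order G)))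

-- u_i lies in TT(G): some other member of its class is adjacent to it
-- (then all members of the class are true twins); otherwise, if the class is
-- not a singleton, it is a false twin class.
isTrueTwin : (G : Graph) → Fin (order G) → Bool
isTrueTwin G i = foldr _∨_ false
  (map (λ j → not (eqB j i) ∧ twinRel G i j ∧ adj G i j) (allFin (order G)))

𝒯vertex : (G : Graph) → (Fin (order G) → Graph) → Fin (order G) → ℕ
𝒯vertex G H i =
  if isSingleton G i then order (H i)
  else if isTrueTwin G i
    then minList (map (λ { (j , l) → (order (H j) ∸ Δ (H j)) + (order (H l) ∸ Δ (H l)) })
                      classPairs)
    else minList (map (λ { (j , l) → δ (H j) + δ (H l) + 2 }) classPairs)
  where
  classPairs : List (Fin (order G) × Fin (order G))
  classPairs = distinctPairs (λ j l → twinRel G i j ∧ twinRel G i l)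

𝒯 : (G : Graph) → (Fin (order G) → Graph) → ℕ
𝒯 G H = minList (map (𝒯vertex G H) (allFin (order G)))

module Submission where

-- Distances in G ∘ 𝓗 come from G: vertices of different copies i ≠ l are at distance d_G(u_i,u_l),
-- and two vertices of one copy at distance 1 or 2 according to adjacency in H_i (u_i has a
-- neighbour). So the vertices distinguishing x = (i,a) and y = (j,b) are: for i = j, exactly the
-- (i,c) with c ∈ 𝒞_{H_i}(a,b); for non-twins u_i, u_j, at least a whole copy H_z with u_z separating
-- them; for true twins, exactly the vertices outside N[a] in copy i and outside N[b] in copy j; for
-- false twins, exactly N[a] ∪ N[b]. Hence every pair has at least min{𝒯, 𝒞(𝓗)} distinguishers,
-- and a pair of copies realising that minimum (with a, b of extremal degree) has exactly that many.
-- The largest k admitting a k-metric generator is this minimal number of distinguishers.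

open import Defs hiding (sym)
open import Data.Bool using (Bool; true; false; _∧_; _∨_; not; _xor_)
open import Data.Bool.ListAction using (all; any)
open import Data.Bool.Properties
  using (not-injective; xor-same; ∧-conicalˡ; ∧-conicalʳ; ∨-conicalˡ; ∨-conicalʳ)
open import Data.Fin using (Fin; _≟_) renaming (zero to fzero; suc to fsuc)
open import Data.Fin.Properties using (any?)
open import Data.List using (List; []; _∷_; _++_; map; length; filter; allFin)
open import Data.List.Membership.Propositional using (_∈_)
open import Data.List.Membership.Propositional.Properties
  using (∈-map⁺; ∈-map⁻; ∈-filter⁺; ∈-filter⁻; ∈-allFin; ∈-++⁺ˡ; ∈-++⁺ʳ; ∈-concatMap⁺; ∈-concatMap⁻;
         foldr-selective)
open import Data.List.Properties
  using (length-filter; length-map; length-++; length-tabulate; length-removeAt′; foldr-preservesᵒ;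
         filter-all)
open import Data.List.Relation.Binary.Subset.Propositional using (_⊆_)
open import Data.List.Relation.Unary.All as All using (All; []; _∷_)
open import Data.List.Relation.Unary.All.Properties using (++⁺)
open import Data.List.Relation.Unary.Any as Any using (Any; here; there; _─_)
open import Data.List.Relation.Unary.Unique.Propositional using (Unique; []; _∷_)
import Data.List.Relation.Unary.Unique.Propositional.Properties as Unique
open import Data.Nat using (ℕ; zero; suc; _+_; _∸_; _≤_; _<_; _⊓_; _⊔_; z≤n; s≤s; _≤?_)
open import Data.Nat.Induction using (<-rec)
open import Data.Nat.Properties hiding (_≟_)
open import Data.Product using (Σ; _×_; _,_; ∃; proj₁; proj₂)
open import Data.Sum using (_⊎_; inj₁; inj₂)
open import Data.Unit using (⊤; tt)
open import Function using (_∘_; _∘′_)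
open import Function.Bundles using (_⇔_; mk⇔)
open import Relation.Binary.PropositionalEquality
open import Relation.Nullary using (¬_; Dec; yes; no; contradiction)
open import Relation.Nullary.Decidable using (dec-true; dec-false; _×-dec_)
open import Relation.Unary using (Decidable)

minList-≤ : ∀ {xs y} → y ∈ xs → minList xs ≤ y
minList-≤ {x ∷ xs} {y} y∈ = foldr-preservesᵒ ⊓-≤ x xs (head-or-tail y∈)
  where
  ⊓-≤ : ∀ m n → m ≤ y ⊎ n ≤ y → m ⊓ n ≤ y
  ⊓-≤ m n (inj₁ m≤y) = m≤n⇒m⊓o≤n n m≤y
  ⊓-≤ m n (inj₂ n≤y) = m≤n⇒o⊓m≤n m n≤y
  head-or-tail : ∀ {x xs} → y ∈ x ∷ xs → x ≤ y ⊎ Any (_≤ y) xs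
  head-or-tail (here refl) = inj₁ ≤-refl
  head-or-tail (there y∈) = inj₂ (Any.map (λ { refl → ≤-refl }) y∈)

minList-∈ : ∀ {xs y} → y ∈ xs → minList xs ∈ xs
minList-∈ {x ∷ xs} _ with foldr-selective ⊓-sel x xs
... | inj₁ min≡x  = here min≡x
... | inj₂ min∈xs = there min∈xs

maxList-≥ : ∀ {xs y} → y ∈ xs → y ≤ maxList xs
maxList-≥ {x ∷ xs} {y} y∈ = foldr-preservesᵒ ⊔-≥ x xs (head-or-tail y∈)
  where
  ⊔-≥ : ∀ m n → y ≤ m ⊎ y ≤ n → y ≤ m ⊔ n
  ⊔-≥ m n (inj₁ y≤m) = m≤n⇒m≤n⊔o n y≤m
  ⊔-≥ m n (inj₂ y≤n) = m≤n⇒m≤o⊔n m y≤n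
  head-or-tail : ∀ {x xs} → y ∈ x ∷ xs → y ≤ x ⊎ Any (y ≤_) xs
  head-or-tail (here refl) = inj₁ ≤-refl
  head-or-tail (there y∈) = inj₂ (Any.map (λ { refl → ≤-refl }) y∈)

maxList-∈ : ∀ {xs y} → y ∈ xs → maxList xs ∈ xs
maxList-∈ {x ∷ xs} _ with foldr-selective ⊔-sel x xs
... | inj₁ max≡x  = here max≡x
... | inj₂ max∈xs = there max∈xs

module _ {A : Set} (f : A → ℕ) where

  minList-map-≤ : ∀ {xs x} → x ∈ xs → minList (map f xs) ≤ f x
  minList-map-≤ = minList-≤ ∘ ∈-map⁺ f

  minList-map-attained : ∀ {xs x} → x ∈ xs → ∃ λ y → y ∈ xs × minList (map f xs) ≡ f y
  minList-map-attained = ∈-map⁻ f ∘ minList-∈ ∘ ∈-map⁺ f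

  maxList-map-≥ : ∀ {xs x} → x ∈ xs → f x ≤ maxList (map f xs)
  maxList-map-≥ = maxList-≥ ∘ ∈-map⁺ f

  maxList-map-attained : ∀ {xs x} → x ∈ xs → ∃ λ y → y ∈ xs × maxList (map f xs) ≡ f y
  maxList-map-attained = ∈-map⁻ f ∘ maxList-∈ ∘ ∈-map⁺ f

module _ {A : Set} (p : A → Bool) where

  all≡true⇒ : ∀ {xs} → all p xs ≡ true → ∀ {z} → z ∈ xs → p z ≡ true
  all≡true⇒ {x ∷ xs} e z∈ with p x in px
  all≡true⇒ {x ∷ xs} e (here refl) | true = px
  all≡true⇒ {x ∷ xs} e (there z∈) | true = all≡true⇒ e z∈

  all≡true⇐ : ∀ {xs} → (∀ {z} → z ∈ xs → p z ≡ true) → all p xs ≡ true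
  all≡true⇐ {[]} _ = refl
  all≡true⇐ {x ∷ xs} h rewrite h (here refl) = all≡true⇐ (h ∘′ there)

  all≡false⇒ : ∀ {xs} → all p xs ≡ false → ∃ λ z → z ∈ xs × p z ≡ false
  all≡false⇒ {x ∷ xs} e with p x in px
  ... | true  = let z , z∈ , pz = all≡false⇒ e in z , there z∈ , pz
  ... | false = x , here refl , px

  any≡true⇒ : ∀ {xs} → any p xs ≡ true → ∃ λ z → z ∈ xs × p z ≡ true
  any≡true⇒ {x ∷ xs} e with p x in px
  ... | true  = x , here refl , px
  ... | false = let z , z∈ , pz = any≡true⇒ e in z , there z∈ , pz

  any≡true⇐ : ∀ {xs z} → z ∈ xs → p z ≡ true → any p xs ≡ true
  any≡true⇐ {x ∷ xs} (here refl) pz rewrite pz = refl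
  any≡true⇐ {x ∷ xs} (there z∈) pz with p x
  ... | true  = refl
  ... | false = any≡true⇐ z∈ pz

∈-─ : ∀ {A : Set} {x y : A} {ys} (x∈ : x ∈ ys) → y ∈ ys → y ≢ x → y ∈ (ys ─ x∈)
∈-─ (here refl) (here refl) y≢x = contradiction refl y≢x
∈-─ (here refl) (there y∈)  _   = y∈
∈-─ (there x∈)  (here refl) _   = here refl
∈-─ (there x∈)  (there y∈)  y≢x = there (∈-─ x∈ y∈ y≢x)

Unique-length-mono-⊆ : ∀ {A : Set} {xs ys : List A} → Unique xs → xs ⊆ ys → length xs ≤ length ys
Unique-length-mono-⊆ {xs = []} _ _ = z≤n
Unique-length-mono-⊆ {xs = x ∷ xs} {ys} (x∉xs ∷ uxs) xs⊆ys = begin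
  suc (length xs)            ≤⟨ s≤s (Unique-length-mono-⊆ uxs xs⊆ys─x) ⟩
  suc (length (ys ─ x∈ys))   ≡⟨ length-removeAt′ ys _ ⟨
  length ys                  ∎
  where
  open ≤-Reasoning
  x∈ys : x ∈ ys
  x∈ys = xs⊆ys (here refl)
  xs⊆ys─x : xs ⊆ (ys ─ x∈ys)
  xs⊆ys─x z∈ = ∈-─ x∈ys (xs⊆ys (there z∈)) (λ { refl → All.lookup x∉xs z∈ refl })

countB-≤ : ∀ {n} (p : Fin n → Bool) → countB p ≤ n
countB-≤ {n} p = subst (countB p ≤_) (length-tabulate _) (length-filter _ (allFin n))

countB-not : ∀ {n} (p : Fin n → Bool) → countB (not ∘ p) ≡ n ∸ countB p
countB-not {n} p = begin
  countB (not ∘ p)                            ≡⟨ m+n∸m≡n (countB p) _ ⟨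
  countB p + countB (not ∘ p) ∸ countB p     ≡⟨ cong (_∸ countB p) (count-split (allFin n)) ⟩
  length (allFin n) ∸ countB p               ≡⟨ cong (_∸ countB p) (length-tabulate _) ⟩
  n ∸ countB p                               ∎
  where
  open ≡-Reasoning
  count : (Fin n → Bool) → List (Fin n) → ℕ
  count q xs = length (filter (λ z → q z Data.Bool.≟ true) xs)
  count-split : ∀ xs → count p xs + count (not ∘ p) xs ≡ length xs
  count-split [] = refl
  count-split (x ∷ xs) with p x
  ... | true  = cong suc (count-split xs)
  ... | false = trans (+-suc (count p xs) _) (cong suc (count-split xs))

+-two≡suc+suc : ∀ m n → m + n + 2 ≡ suc m + suc n
+-two≡suc+suc m n = trans (+-comm (m + n) 2) (cong suc (sym (+-suc m n)))

least-witness : ∀ {P : ℕ → Set} → Decidable P → ∀ {n} → P n →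
                ∃ λ m → P m × (∀ {k} → P k → m ≤ k)
least-witness {P} P? {n} = <-rec (λ n → P n → Least) step n
  where
  Least : Set
  Least = ∃ λ m → P m × (∀ {k} → P k → m ≤ k)
  step : ∀ n → (∀ {k} → k < n → P k → Least) → P n → Least
  step n smaller pn with anyUpTo? P? n
  ... | yes (k , k<n , pk) = smaller k<n pk
  ... | no none            = n , pn , λ {k} pk → ≮⇒≥ (λ k<n → none (k , k<n , pk))

Fin-other : ∀ {n} → 2 ≤ n → (a : Fin n) → ∃ λ b → b ≢ a
Fin-other {suc zero} (s≤s ()) _
Fin-other {suc (suc n)} _ fzero    = fsuc fzero , λ ()
Fin-other {suc (suc n)} _ (fsuc a) = fzero , λ ()

Fin-pair : ∀ {n} → 2 ≤ n → Σ (Fin n) λ a → Σ (Fin n) λ b → a ≢ b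
Fin-pair {suc zero} (s≤s ())
Fin-pair {suc (suc n)} _ = fzero , fsuc fzero , λ ()

module MetricProperties {V : Set} (Adj : V → V → Set) where
  open Metric Adj

  walk-length-zero : ∀ {x y} → Walk x y 0 → x ≡ y
  walk-length-zero here = refl

  IsDist-unique : ∀ {x w d d′} → IsDist x w d → IsDist x w d′ → d ≡ d′
  IsDist-unique (p , p-min) (q , q-min) = ≤-antisym (p-min _ q) (q-min _ p)

  IsDist-refl : ∀ {x} → IsDist x x 0
  IsDist-refl = here , λ _ _ → z≤n

  IsDist-two : ∀ {x w} → Walk x w 2 → x ≢ w → ¬ Adj x w → IsDist x w 2
  IsDist-two {x} {w} p x≢w ¬adj = p , shortest
    where
    shortest : ∀ k → Walk x w k → 2 ≤ k
    shortest zero q                  = contradiction (walk-length-zero q) x≢w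
    shortest (suc zero) (step a here) = contradiction a ¬adj
    shortest (suc (suc k)) _         = s≤s (s≤s z≤n)

  Distinguishes-sym : ∀ {w x y} → Distinguishes w x y → Distinguishes w y x
  Distinguishes-sym D d₁ d₂ p q d₁≡d₂ = D d₂ d₁ q p (sym d₁≡d₂)

  distinguishes-self : ∀ {x y} → x ≢ y → Distinguishes x x y
  distinguishes-self x≢y d₁ d₂ p q refl with IsDist-unique p IsDist-refl
  ... | refl = x≢y (sym (walk-length-zero (proj₁ q)))

  distinguishes-other : ∀ {x y} → x ≢ y → Distinguishes y x y
  distinguishes-other x≢y = Distinguishes-sym (distinguishes-self (x≢y ∘ sym))

  equidistant⇒¬distinguishes : ∀ {w x y d} → IsDist x w d → IsDist y w d → ¬ Distinguishes w x y
  equidistant⇒¬distinguishes p q D = D _ _ p q refl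

  module Irreflexive (irreflexive : ∀ {x} → ¬ Adj x x) where

    IsDist-one : ∀ {x w} → Adj x w → IsDist x w 1
    IsDist-one {x} {w} a = step a here , shortest
      where
      shortest : ∀ k → Walk x w k → 1 ≤ k
      shortest zero q with refl ← walk-length-zero q = contradiction a irreflexive
      shortest (suc k) _ = s≤s z≤n

    adjacent-distinguishes : ∀ {w x y} → Adj x w → ¬ Adj y w → Distinguishes w x y
    adjacent-distinguishes a ¬a _ _ p (q , _) refl with IsDist-unique p (IsDist-one a) | q
    ... | refl | step a′ here = ¬a a′

  DistinguishingList : V → V → List V → Set
  DistinguishingList x y ws = Unique ws × All (λ w → Distinguishes w x y) ws

  record SparselyDistinguishedPair (m : ℕ) : Set where
    field
      {x y}     : V
      x≢y       : x ≢ y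
      witnesses : List V
      bounded   : length witnesses ≤ m
      complete  : ∀ {w} → Distinguishes w x y → w ∈ witnesses

  record Distinguishers (x y : V) (n : ℕ) : Set where
    field
      list     : List V
      unique   : Unique list
      sound    : All (λ w → Distinguishes w x y) list
      complete : ∀ {w} → Distinguishes w x y → w ∈ list
      size     : length list ≡ n

    distinguishingList : DistinguishingList x y list
    distinguishingList = unique , sound

    sparselyDistinguished : ∀ {m} → x ≢ y → n ≤ m → SparselyDistinguishedPair m
    sparselyDistinguished x≢y n≤m = record
      { x≢y = x≢y ; witnesses = list ; bounded = ≤-trans (≤-reflexive size) n≤m ; complete = complete }

  module _ {m : ℕ} (sparse : SparselyDistinguishedPair m) where
    open SparselyDistinguishedPair sparse

    distinguishingList-length≤ : ∀ {ws} → DistinguishingList x y ws → length ws ≤ m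
    distinguishingList-length≤ (unique , distinguish) =
      ≤-trans (Unique-length-mono-⊆ unique (complete ∘ All.lookup distinguish)) bounded

    generator≤ : ∀ {S k} → IsKMetricGenerator S k → k ≤ m
    generator≤ gen =
      let ws , k≤ , unique , _ , distinguish = gen x y x≢y
      in ≤-trans k≤ (distinguishingList-length≤ (unique , distinguish))

    two≤ : 2 ≤ m
    two≤ = distinguishingList-length≤
      (((x≢y ∷ []) ∷ [] ∷ []) , distinguishes-self x≢y ∷ distinguishes-other x≢y ∷ [])

    kMetricDimensional⇔ : (∀ {x y} → x ≢ y → ∃ λ ws → DistinguishingList x y ws × m ≤ length ws) →
                          ∀ k → KMetricDimensional k ⇔ k ≡ m
    kMetricDimensional⇔ lists k = mk⇔ to from
      where
      everything : IsKMetricGenerator (λ _ → ⊤) m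
      everything x y x≢y =
        let ws , (unique , distinguish) , m≤ = lists x≢y
        in ws , m≤ , unique , All.tabulate (λ _ → tt) , distinguish

      to : KMetricDimensional k → k ≡ m
      to (_ , (_ , gen) , maximal) =
        ≤-antisym (generator≤ gen) (≮⇒≥ (λ k<m → maximal m k<m (_ , everything)))

      from : k ≡ m → KMetricDimensional k
      from refl = ≤-trans (s≤s z≤n) two≤ , (_ , everything) ,
                  λ k′ m<k′ (_ , gen) → <⇒≱ m<k′ (generator≤ gen)

eqB-refl : ∀ {n} (x : Fin n) → eqB x x ≡ true
eqB-refl x = dec-true (x ≟ x) refl

eqB-≢ : ∀ {n} {x y : Fin n} → x ≢ y → eqB x y ≡ false
eqB-≢ {x = x} {y} = dec-false (x ≟ y)

eqB≡false⇒≢ : ∀ {n} {x y : Fin n} → eqB x y ≡ false → x ≢ y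
eqB≡false⇒≢ {x = x} e refl = contradiction (trans (sym (eqB-refl x)) e) λ ()

∧≡true⇒ : ∀ {a b} → (a ∧ b) ≡ true → a ≡ true × b ≡ true
∧≡true⇒ e = ∧-conicalˡ _ _ e , ∧-conicalʳ _ _ e

∨≡false⇒ : ∀ {a b} → (a ∨ b) ≡ false → a ≡ false × b ≡ false
∨≡false⇒ e = ∨-conicalˡ _ _ e , ∨-conicalʳ _ _ e

xor≡false⇒≡ : ∀ {a b} → (a xor b) ≡ false → a ≡ b
xor≡false⇒≡ {true}  {true}  _ = refl
xor≡false⇒≡ {false} {false} _ = refl

xor≡true⇒≢ : ∀ {a b} → (a xor b) ≡ true → a ≢ b
xor≡true⇒≢ {true}  {true}  () refl
xor≡true⇒≢ {false} {false} () refl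

∈-distinctPairs⁺ : ∀ {n} {p : Fin n → Fin n → Bool} {x y} → x ≢ y → p x y ≡ true →
                   (x , y) ∈ distinctPairs p
∈-distinctPairs⁺ {n} {p} {x} {y} x≢y pxy =
  ∈-concatMap⁺ _ (Any.map (λ { refl → ∈-map⁺ _ (∈-filter⁺ _ (∈-allFin y) selected) }) (∈-allFin x))
  where
  selected : (not (eqB x y) ∧ p x y) ≡ true
  selected rewrite eqB-≢ x≢y | pxy = refl

∈-distinctPairs⁻ : ∀ {n} {p : Fin n → Fin n → Bool} {x y} → (x , y) ∈ distinctPairs p →
                   x ≢ y × p x y ≡ true
∈-distinctPairs⁻ {n} {p} {x} {y} xy∈ with Any.satisfied (∈-concatMap⁻ _ {xs = allFin n} xy∈)
... | x′ , xy∈row with ∈-map⁻ _ xy∈row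
... | y′ , y′∈ , refl =
  let selected       = proj₂ (∈-filter⁻ (λ y → (not (eqB x y) ∧ p x y) Data.Bool.≟ true) {xs = allFin n} y′∈)
      distinct , pxy = ∧≡true⇒ selected
  in eqB≡false⇒≢ (not-injective distinct) , pxy

module _ (K : Graph) where

  δ≤degree : ∀ a → δ K ≤ degree K a
  δ≤degree a = minList-map-≤ (degree K) (∈-allFin a)

  degree≤Δ : ∀ a → degree K a ≤ Δ K
  degree≤Δ a = maxList-map-≥ (degree K) (∈-allFin a)

  δ-attained : Fin (order K) → ∃ λ a → δ K ≡ degree K a
  δ-attained a = let b , _ , e = minList-map-attained (degree K) (∈-allFin a) in b , e

  Δ-attained : Fin (order K) → ∃ λ a → Δ K ≡ degree K a
  Δ-attained a = let b , _ , e = maxList-map-attained (degree K) (∈-allFin a) in b , e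

  𝒞≤𝒞pair : ∀ {a b} → a ≢ b → 𝒞 K ≤ 𝒞pair K a b
  𝒞≤𝒞pair a≢b = minList-map-≤ _ (∈-distinctPairs⁺ a≢b refl)

  𝒞-attained : 2 ≤ order K →
               Σ (Fin (order K)) λ a → Σ (Fin (order K)) λ b → a ≢ b × 𝒞 K ≡ 𝒞pair K a b
  𝒞-attained 2≤ with Fin-pair 2≤
  ... | a , b , a≢b with minList-map-attained _ (∈-distinctPairs⁺ {p = λ _ _ → true} a≢b refl)
  ...   | (a′ , b′) , ab∈ , e = a′ , b′ , proj₁ (∈-distinctPairs⁻ ab∈) , e

  𝒞≤order : 2 ≤ order K → 𝒞 K ≤ order K
  𝒞≤order 2≤ = let a , b , a≢b = Fin-pair 2≤ in ≤-trans (𝒞≤𝒞pair a≢b) (countB-≤ _)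

Twins : (G : Graph) → Fin (order G) → Fin (order G) → Set
Twins G x y = ∀ z → z ≢ x → z ≢ y → adj G x z ≡ adj G y z

module Twin (G : Graph) where

  adj-≢ : ∀ {x y} → adj G x y ≡ true → y ≢ x
  adj-≢ {x} e refl = contradiction (trans (sym e) (irrefl G x)) λ ()

  adj-sym : ∀ {x y} → adj G x y ≡ true → adj G y x ≡ true
  adj-sym {x} {y} e = trans (Graph.sym G y x) e

  Twins-refl : ∀ {x} → Twins G x x
  Twins-refl _ _ _ = refl

  Twins-sym : ∀ {x y} → Twins G x y → Twins G y x
  Twins-sym t z z≢y z≢x = sym (t z z≢x z≢y)

  Twins-trans : ∀ {x y z} → Twins G x y → Twins G y z → Twins G x z
  Twins-trans {x} {y} {z} t u w w≢x w≢z with x ≟ y | z ≟ y | x ≟ z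
  ... | yes refl | _        | _        = u w w≢x w≢z
  ... | no _     | yes refl | _        = t w w≢x w≢z
  ... | no _     | no _     | yes refl = refl
  ... | no x≢y   | no z≢y   | no x≢z with w ≟ y
  ...   | no w≢y   = trans (t w w≢x w≢y) (u w w≢y w≢z)
  ...   | yes refl = begin
    adj G x y  ≡⟨ Graph.sym G x y ⟩
    adj G y x  ≡⟨ u x x≢y x≢z ⟩
    adj G z x  ≡⟨ Graph.sym G z x ⟩
    adj G x z  ≡⟨ t z (x≢z ∘ sym) z≢y ⟩
    adj G y z  ≡⟨ Graph.sym G y z ⟩
    adj G z y  ∎
    where open ≡-Reasoning

  twinRel⇒Twins : ∀ {x y} → twinRel G x y ≡ true → Twins G x y
  twinRel⇒Twins {x} {y} e z z≢x z≢y
    with all≡true⇒ (λ z → (eqB z x ∨ eqB z y) ∨ not (adj G x z xor adj G y z)) e (∈-allFin z)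
  ... | holds rewrite eqB-≢ z≢x | eqB-≢ z≢y = xor≡false⇒≡ (not-injective holds)

  Twins⇒twinRel : ∀ {x y} → Twins G x y → twinRel G x y ≡ true
  Twins⇒twinRel {x} {y} t = all≡true⇐ _ {allFin (order G)} holds
    where
    holds : ∀ {z} → z ∈ allFin (order G) → ((eqB z x ∨ eqB z y) ∨ not (adj G x z xor adj G y z)) ≡ true
    holds {z} _ with z ≟ x | z ≟ y
    ... | yes _  | _      = refl
    ... | no _   | yes _  = refl
    ... | no z≢x | no z≢y rewrite t z z≢x z≢y = cong not (xor-same (adj G y z))

  twinRel≡false⇒separated : ∀ {x y} → twinRel G x y ≡ false →
                            ∃ λ z → z ≢ x × z ≢ y × adj G x z ≢ adj G y z
  twinRel≡false⇒separated {x} {y} e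
    with all≡false⇒ (λ z → (eqB z x ∨ eqB z y) ∨ not (adj G x z xor adj G y z)) {allFin (order G)} e
  ... | z , _ , fails =
    let outside , differ = ∨≡false⇒ fails
        z≢x , z≢y = ∨≡false⇒ outside
    in z , eqB≡false⇒≢ z≢x , eqB≡false⇒≢ z≢y , xor≡true⇒≢ (not-injective differ)

  isSingleton≡false⇒twin : ∀ {i} → isSingleton G i ≡ false → ∃ λ j → j ≢ i × Twins G i j
  isSingleton≡false⇒twin {i} e
    with all≡false⇒ (λ j → eqB j i ∨ not (twinRel G i j)) {allFin (order G)} e
  ... | j , _ , fails =
    let j≢i , twin = ∨≡false⇒ fails
    in j , eqB≡false⇒≢ j≢i , twinRel⇒Twins (not-injective twin)

  twin⇒isSingleton≡false : ∀ {i j} → j ≢ i → Twins G i j → isSingleton G i ≡ false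
  twin⇒isSingleton≡false {i} {j} j≢i t with isSingleton G i in e
  ... | false = refl
  ... | true with all≡true⇒ (λ j → eqB j i ∨ not (twinRel G i j)) e (∈-allFin j)
  ...   | holds rewrite eqB-≢ j≢i | Twins⇒twinRel t = contradiction holds λ ()

  isTrueTwin≡true⇒ : ∀ {i} → isTrueTwin G i ≡ true →
                     ∃ λ j → j ≢ i × Twins G i j × adj G i j ≡ true
  isTrueTwin≡true⇒ {i} e
    with any≡true⇒ (λ j → not (eqB j i) ∧ twinRel G i j ∧ adj G i j) {allFin (order G)} e
  ... | j , _ , holds =
    let j≠i , rest = ∧≡true⇒ {not (eqB j i)} holds
        twin , a   = ∧≡true⇒ {twinRel G i j} rest
    in j , eqB≡false⇒≢ (not-injective j≠i) , twinRel⇒Twins twin , a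

  adjacentTwin⇒isTrueTwin : ∀ {i j} → j ≢ i → Twins G i j → adj G i j ≡ true → isTrueTwin G i ≡ true
  adjacentTwin⇒isTrueTwin {i} {j} j≢i t a = any≡true⇐ _ (∈-allFin j) holds
    where
    holds : (not (eqB j i) ∧ twinRel G i j ∧ adj G i j) ≡ true
    holds rewrite eqB-≢ j≢i | Twins⇒twinRel t | a = refl

  adjacentTwins-spread : ∀ {x y z} → Twins G x y → adj G x y ≡ true → Twins G x z → z ≢ x → z ≢ y →
                         adj G x z ≡ true × adj G y z ≡ true
  adjacentTwins-spread {x} {y} {z} t a u z≢x z≢y =
    let yz = adj-sym (trans (sym (u y (adj-≢ a) (z≢y ∘ sym))) a)
    in trans (t z z≢x z≢y) yz , yz

  twinClass-adjacency : ∀ {i j l} → Twins G i j → Twins G i l → j ≢ l → adj G j l ≡ isTrueTwin G i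
  twinClass-adjacency {i} {j} {l} tj tl j≢l with isTrueTwin G i in e
  ... | true  = trueClass
    where
    adjacent-to-i : ∀ {k} → k ≢ i → Twins G i k → adj G i k ≡ true
    adjacent-to-i {k} k≢i tk with isTrueTwin≡true⇒ e
    ... | j′ , j′≢i , tj′ , a with k ≟ j′
    ...   | yes refl = a
    ...   | no k≢j′  = proj₁ (adjacentTwins-spread tj′ a tk k≢i k≢j′)
    trueClass : adj G j l ≡ true
    trueClass with j ≟ i | l ≟ i
    ... | yes refl | _        = adjacent-to-i (j≢l ∘ sym) tl
    ... | no j≢i   | yes refl = adj-sym (adjacent-to-i j≢i tj)
    ... | no j≢i   | no l≢i   = proj₂ (adjacentTwins-spread tj (adjacent-to-i j≢i tj) tl l≢i (j≢l ∘ sym))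
  ... | false = falseClass
    where
    falseClass : adj G j l ≡ false
    falseClass with adj G j l in a
    ... | false = refl
    ... | true with j ≟ i | l ≟ i
    ...   | yes refl | _        = contradiction (trans (sym (adjacentTwin⇒isTrueTwin (j≢l ∘ sym) tl a)) e) λ ()
    ...   | no j≢i   | yes refl = contradiction (trans (sym (adjacentTwin⇒isTrueTwin j≢i tj (adj-sym a))) e) λ ()
    ...   | no j≢i   | no l≢i   =
      let tjl = Twins-trans (Twins-sym tj) tl
          ji  = proj₁ (adjacentTwins-spread tjl a (Twins-sym tj) (j≢i ∘ sym) (l≢i ∘ sym))
      in contradiction (trans (sym (adjacentTwin⇒isTrueTwin j≢i tj (adj-sym ji))) e) λ ()

  -- Definitionally the list classPairs in the definition of 𝒯vertex.
  twinPairs : Fin (order G) → List (Fin (order G) × Fin (order G))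
  twinPairs i = distinctPairs (λ j l → twinRel G i j ∧ twinRel G i l)

  ∈-twinPairs⁺ : ∀ {i j l} → j ≢ l → Twins G i j → Twins G i l → (j , l) ∈ twinPairs i
  ∈-twinPairs⁺ j≢l tj tl = ∈-distinctPairs⁺ j≢l (cong₂ _∧_ (Twins⇒twinRel tj) (Twins⇒twinRel tl))

  ∈-twinPairs⁻ : ∀ {i j l} → (j , l) ∈ twinPairs i → j ≢ l × Twins G i j × Twins G i l
  ∈-twinPairs⁻ {i} {j} jl∈ =
    let j≢l , both = ∈-distinctPairs⁻ jl∈
        tj , tl    = ∧≡true⇒ {twinRel G i j} both
    in j≢l , twinRel⇒Twins tj , twinRel⇒Twins tl

  twinPairs-minimum : ∀ {i j} → j ≢ i → Twins G i j → (f : Fin (order G) × Fin (order G) → ℕ) →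
                      ∃ λ jl → jl ∈ twinPairs i × minList (map f (twinPairs i)) ≡ f jl
  twinPairs-minimum j≢i t f = minList-map-attained f (∈-twinPairs⁺ (j≢i ∘ sym) Twins-refl t)

module Invariants (G : Graph) (H : Fin (order G) → Graph) where
  open Twin G

  𝒞fam≤𝒞 : ∀ i → 𝒞fam G H ≤ 𝒞 (H i)
  𝒞fam≤𝒞 i = minList-map-≤ (λ i → 𝒞 (H i)) (∈-allFin i)

  𝒞fam-attained : Fin (order G) → ∃ λ i → 𝒞fam G H ≡ 𝒞 (H i)
  𝒞fam-attained i = let j , _ , e = minList-map-attained (λ i → 𝒞 (H i)) (∈-allFin i) in j , e

  𝒯≤𝒯vertex : ∀ i → 𝒯 G H ≤ 𝒯vertex G H i
  𝒯≤𝒯vertex i = minList-map-≤ (𝒯vertex G H) (∈-allFin i)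

  𝒯-attained : Fin (order G) → ∃ λ i → 𝒯 G H ≡ 𝒯vertex G H i
  𝒯-attained i = let j , _ , e = minList-map-attained (𝒯vertex G H) (∈-allFin i) in j , e

  trueTwinCost : Fin (order G) → Fin (order G) → ℕ
  trueTwinCost j l = (order (H j) ∸ Δ (H j)) + (order (H l) ∸ Δ (H l))

  falseTwinCost : Fin (order G) → Fin (order G) → ℕ
  falseTwinCost j l = δ (H j) + δ (H l) + 2

  -- For a twin j of i, the branch of 𝒯vertex G H i is selected by adj G i j (twinClass-adjacency).
  𝒯vertex≤trueTwinCost : ∀ {i j} → j ≢ i → Twins G i j → adj G i j ≡ true →
                         𝒯vertex G H i ≤ trueTwinCost i j
  𝒯vertex≤trueTwinCost {i} {j} j≢i t a
    rewrite twin⇒isSingleton≡false j≢i t | sym (twinClass-adjacency Twins-refl t (j≢i ∘ sym)) | a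
    = minList-map-≤ _ (∈-twinPairs⁺ (j≢i ∘ sym) Twins-refl t)

  𝒯vertex≤falseTwinCost : ∀ {i j} → j ≢ i → Twins G i j → adj G i j ≡ false →
                          𝒯vertex G H i ≤ falseTwinCost i j
  𝒯vertex≤falseTwinCost {i} {j} j≢i t a
    rewrite twin⇒isSingleton≡false j≢i t | sym (twinClass-adjacency Twins-refl t (j≢i ∘ sym)) | a
    = minList-map-≤ _ (∈-twinPairs⁺ (j≢i ∘ sym) Twins-refl t)

  𝒯vertex-singleton : ∀ {i} → isSingleton G i ≡ true → 𝒯vertex G H i ≡ order (H i)
  𝒯vertex-singleton s rewrite s = refl

  𝒯vertex-trueClass : ∀ {i j} → isSingleton G i ≡ false → isTrueTwin G i ≡ true → j ≢ i → Twins G i j →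
                      ∃ λ jl → jl ∈ twinPairs i × 𝒯vertex G H i ≡ trueTwinCost (proj₁ jl) (proj₂ jl)
  𝒯vertex-trueClass s class j≢i t rewrite s | class = twinPairs-minimum j≢i t _

  𝒯vertex-falseClass : ∀ {i j} → isSingleton G i ≡ false → isTrueTwin G i ≡ false → j ≢ i → Twins G i j →
                       ∃ λ jl → jl ∈ twinPairs i × 𝒯vertex G H i ≡ falseTwinCost (proj₁ jl) (proj₂ jl)
  𝒯vertex-falseClass s class j≢i t rewrite s | class = twinPairs-minimum j≢i t _

  data 𝒯vertexView (i : Fin (order G)) : Set where
    singleton  : 𝒯vertex G H i ≡ order (H i) → 𝒯vertexView i
    trueTwins  : ∀ {j l} → j ≢ l → Twins G j l → adj G j l ≡ true →
                 𝒯vertex G H i ≡ trueTwinCost j l → 𝒯vertexView i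
    falseTwins : ∀ {j l} → j ≢ l → Twins G j l → adj G j l ≡ false →
                 𝒯vertex G H i ≡ falseTwinCost j l → 𝒯vertexView i

  𝒯vertex-view : ∀ i → 𝒯vertexView i
  𝒯vertex-view i with isSingleton G i in s | isTrueTwin G i in class
  ... | true  | _     = singleton (𝒯vertex-singleton s)
  ... | false | true  =
    let j₀ , j₀≢i , t₀      = isSingleton≡false⇒twin s
        (j , l) , jl∈ , value = 𝒯vertex-trueClass s class j₀≢i t₀
        j≢l , tj , tl        = ∈-twinPairs⁻ jl∈
    in trueTwins j≢l (Twins-trans (Twins-sym tj) tl) (trans (twinClass-adjacency tj tl j≢l) class) value
  ... | false | false =
    let j₀ , j₀≢i , t₀      = isSingleton≡false⇒twin s
        (j , l) , jl∈ , value = 𝒯vertex-falseClass s class j₀≢i t₀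
        j≢l , tj , tl        = ∈-twinPairs⁻ jl∈
    in falseTwins j≢l (Twins-trans (Twins-sym tj) tl) (trans (twinClass-adjacency tj tl j≢l) class) value

module GraphDistance (G : Graph) where
  open Metric (λ x y → adj G x y ≡ true) public
  open MetricProperties (λ x y → adj G x y ≡ true) using (walk-length-zero)
  open Twin G

  walk? : ∀ k x y → Dec (Walk x y k)
  walk? zero x y with x ≟ y
  ... | yes refl = yes here
  ... | no x≢y   = no λ { here → x≢y refl }
  walk? (suc k) x y with any? (λ z → (adj G x z Data.Bool.≟ true) ×-dec walk? k z y)
  ... | yes (z , a , w) = yes (step a w)
  ... | no none         = no λ { (step a w) → none (_ , a , w) }

  IsDist-exists : Connected → ∀ x y → ∃ λ d → IsDist x y d
  IsDist-exists connected x y =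
    let d , w , shortest = least-witness (λ k → walk? k x y) (proj₂ (connected x y))
    in d , w , λ k → shortest

  neighbour : 2 ≤ order G → Connected → ∀ x → ∃ λ z → adj G x z ≡ true
  neighbour 2≤ connected x with Fin-other 2≤ x
  ... | y , y≢x with connected x y
  ...   | zero , w                    = contradiction (sym (walk-length-zero w)) y≢x
  ...   | suc _ , step {y = z} a _    = z , a

  twin-walk : ∀ {j l p} → Twins G j l → p ≢ j → p ≢ l → ∀ {k} → Walk j p k →
              ∃ λ k′ → k′ ≤ k × Walk l p k′
  twin-walk t p≢j p≢l here = contradiction refl p≢j
  twin-walk {l = l} t p≢j p≢l (step {y = z} {k = k} a w) with z ≟ l
  ... | yes refl = k , n≤1+n k , w
  ... | no z≢l   = suc k , ≤-refl , step (trans (sym (t z (adj-≢ a) z≢l)) a) w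

  Twins-IsDist : ∀ {j l p d} → Twins G j l → p ≢ j → p ≢ l → IsDist j p d → IsDist l p d
  Twins-IsDist {d = d} t p≢j p≢l (w , shortest) =
    let k , k≤d , w′ = twin-walk t p≢j p≢l w
        d≤k k q      = let k′ , k′≤k , q′ = twin-walk (Twins-sym t) p≢l p≢j q
                       in ≤-trans (shortest k′ q′) k′≤k
    in subst (Walk _ _) (≤-antisym k≤d (d≤k k w′)) w′ , d≤k

module LexProduct (G : Graph) (H : Fin (order G) → Graph) where
  open Twin G
  module GD = GraphDistance G
  open Metric (LexAdj G H) public
  open MetricProperties (LexAdj G H) public

  LexAdj-irrefl : ∀ {x} → ¬ LexAdj G H x x
  LexAdj-irrefl (outer a) = adj-≢ a refl
  LexAdj-irrefl (inner {i} {v} a) = contradiction (trans (sym a) (irrefl (H i) v)) λ ()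

  ¬LexAdj-sameCopy : ∀ {i b c} → adj (H i) b c ≡ false → ¬ LexAdj G H (i , b) (i , c)
  ¬LexAdj-sameCopy ¬a (outer a) = adj-≢ a refl
  ¬LexAdj-sameCopy ¬a (inner a) = contradiction (trans (sym a) ¬a) λ ()

  ¬LexAdj-copies : ∀ {j p b c} → j ≢ p → adj G j p ≡ false → ¬ LexAdj G H (j , b) (p , c)
  ¬LexAdj-copies j≢p ¬a (outer a) = contradiction (trans (sym a) ¬a) λ ()
  ¬LexAdj-copies j≢p ¬a (inner a) = j≢p refl

  project-walk : ∀ {x y k} → Walk x y k → ∃ λ k′ → k′ ≤ k × GD.Walk (proj₁ x) (proj₁ y) k′
  project-walk here = 0 , z≤n , GD.here
  project-walk (step (outer a) w) = let k′ , k′≤k , w′ = project-walk w in suc k′ , s≤s k′≤k , GD.step a w′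
  project-walk (step (inner a) w) = let k′ , k′≤k , w′ = project-walk w in k′ , m≤n⇒m≤1+n k′≤k , w′

  open Irreflexive LexAdj-irrefl public

  separating-distinguishes : ∀ {i j z a b c} → z ≢ j → adj G i z ≡ true → adj G j z ≡ false →
                             Distinguishes (z , c) (i , a) (j , b)
  separating-distinguishes z≢j a ¬a = adjacent-distinguishes (outer a) (¬LexAdj-copies (z≢j ∘ sym) ¬a)

  module _ (point : ∀ i → Fin (order (H i))) where

    lift-walk : ∀ {i l k} → GD.Walk i l (suc k) → ∀ a c → Walk (i , a) (l , c) (suc k)
    lift-walk (GD.step e GD.here) a c = step (outer e) here
    lift-walk (GD.step {y = j} e w@(GD.step _ _)) a c = step (outer e) (lift-walk w (point j) c)

    IsDist-lift : ∀ {i l d} → i ≢ l → GD.IsDist i l d → ∀ a c → IsDist (i , a) (l , c) d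
    IsDist-lift i≢l (GD.here , _) a c = contradiction refl i≢l
    IsDist-lift i≢l (w@(GD.step _ _) , shortest) a c =
      lift-walk w a c , λ k q → let k′ , k′≤k , q′ = project-walk q in ≤-trans (shortest k′ q′) k′≤k

    IsDist-commonNeighbour : ∀ {p q z a c} → adj G p z ≡ true → adj G q z ≡ true →
                             (p , a) ≢ (q , c) → ¬ LexAdj G H (p , a) (q , c) → IsDist (p , a) (q , c) 2
    IsDist-commonNeighbour {z = z} pz qz = IsDist-two (step (outer {w = point z} pz) (step (outer (adj-sym qz)) here))

    twinCopies-¬distinguishes : GD.Connected → ∀ {j l p} → Twins G j l → p ≢ j → p ≢ l →
                                ∀ a b c → ¬ Distinguishes (p , c) (j , a) (l , b)
    twinCopies-¬distinguishes connected {j} {l} {p} t p≢j p≢l a b c =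
      let d , dist = GD.IsDist-exists connected j p
      in equidistant⇒¬distinguishes (IsDist-lift (p≢j ∘ sym) dist a c)
                                    (IsDist-lift (p≢l ∘ sym) (GD.Twins-IsDist t p≢j p≢l dist) b c)

  embed : ∀ i → Fin (order (H i)) → LexVertex G H
  embed i c = i , c

  copyOf : ∀ i → (Fin (order (H i)) → Bool) → List (LexVertex G H)
  copyOf i p = map (embed i) (filter (λ c → p c Data.Bool.≟ true) (allFin _))

  length-copyOf : ∀ i p → length (copyOf i p) ≡ countB p
  length-copyOf i p = length-map (embed i) (filter (λ c → p c Data.Bool.≟ true) (allFin (order (H i))))

  Unique-copyOf : ∀ i p → Unique (copyOf i p)
  Unique-copyOf i p = Unique.map⁺ (λ { refl → refl }) (Unique.filter⁺ _ (Unique.allFin⁺ _))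

  ∈-copyOf⁺ : ∀ {i p c} → p c ≡ true → (i , c) ∈ copyOf i p
  ∈-copyOf⁺ {c = c} pc = ∈-map⁺ _ (∈-filter⁺ _ (∈-allFin c) pc)

  ∈-copyOf⁻ : ∀ {i p w} → w ∈ copyOf i p → ∃ λ c → w ≡ (i , c) × p c ≡ true
  ∈-copyOf⁻ {i} {p} w∈ =
    let c , c∈ , w≡ = ∈-map⁻ (embed i) w∈
    in c , w≡ , proj₂ (∈-filter⁻ (λ c → p c Data.Bool.≟ true) {xs = allFin _} c∈)

  InCopy : Fin (order G) → List (LexVertex G H) → Set
  InCopy i = All (λ w → proj₁ w ≡ i)

  copyOf-InCopy : ∀ i p → InCopy i (copyOf i p)
  copyOf-InCopy i p = All.tabulate λ w∈ → let _ , w≡ , _ = ∈-copyOf⁻ w∈ in cong proj₁ w≡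

  Unique-++-copies : ∀ {i j L₁ L₂} → i ≢ j → InCopy i L₁ → InCopy j L₂ → Unique L₁ → Unique L₂ →
                     Unique (L₁ ++ L₂)
  Unique-++-copies i≢j in₁ in₂ u₁ u₂ =
    Unique.++⁺ u₁ u₂ λ (w∈₁ , w∈₂) →
      i≢j (trans (sym (All.lookup in₁ w∈₁)) (All.lookup in₂ w∈₂))

  length-wholeCopy : ∀ i → length (copyOf i (λ _ → true)) ≡ order (H i)
  length-wholeCopy i = begin
    length (copyOf i (λ _ → true))    ≡⟨ length-copyOf i _ ⟩
    length (filter (λ _ → true Data.Bool.≟ true) (allFin (order (H i))))
      ≡⟨ cong length (filter-all _ {allFin (order (H i))} (All.tabulate λ _ → refl)) ⟩
    length (allFin (order (H i)))     ≡⟨ length-tabulate _ ⟩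
    order (H i)                       ∎
    where open ≡-Reasoning

  closedNeighbourhood : ∀ i → Fin (order (H i)) → List (LexVertex G H)
  closedNeighbourhood i a = (i , a) ∷ copyOf i (adj (H i) a)

  closedNeighbourhood-InCopy : ∀ i a → InCopy i (closedNeighbourhood i a)
  closedNeighbourhood-InCopy i a = refl ∷ copyOf-InCopy i _

  Unique-closedNeighbourhood : ∀ i a → Unique (closedNeighbourhood i a)
  Unique-closedNeighbourhood i a = All.tabulate a∉ ∷ Unique-copyOf i _
    where
    a∉ : ∀ {w} → w ∈ copyOf i (adj (H i) a) → (i , a) ≢ w
    a∉ w∈ refl with ∈-copyOf⁻ w∈
    ... | _ , refl , aa = contradiction (trans (sym aa) (irrefl (H i) a)) λ ()

module Lexicographic (G : Graph) (2≤G : 2 ≤ order G)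
                     (connected : Metric.Connected (λ x y → adj G x y ≡ true))
                     (H : Fin (order G) → Graph) (nontrivial : ∀ i → 2 ≤ order (H i)) where
  open Twin G
  open Invariants G H
  open LexProduct G H

  vertex : Fin (order G)
  vertex = proj₁ (Fin-pair 2≤G)

  point : ∀ i → Fin (order (H i))
  point i = proj₁ (Fin-pair (nontrivial i))

  copy-≢ : ∀ {i} {a b : Fin (order (H i))} → a ≢ b → embed i a ≢ embed i b
  copy-≢ a≢b refl = a≢b refl

  copies-≢ : ∀ {i j} {a : Fin (order (H i))} {b : Fin (order (H j))} → i ≢ j → embed i a ≢ embed j b
  copies-≢ i≢j refl = i≢j refl

  sameCopy-distinguishers : ∀ {i a b} → a ≢ b → Distinguishers (i , a) (i , b) (𝒞pair (H i) a b)
  sameCopy-distinguishers {i} {a} {b} a≢b = record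
    { list     = copyOf i separates
    ; unique   = Unique-copyOf i separates
    ; sound    = All.tabulate λ w∈ → sound (∈-copyOf⁻ w∈)
    ; complete = complete
    ; size     = length-copyOf i separates
    }
    where
    separates : Fin (order (H i)) → Bool
    separates c = eqB c a ∨ eqB c b ∨ (adj (H i) a c xor adj (H i) b c)

    sound : ∀ {w} → (∃ λ c → w ≡ (i , c) × separates c ≡ true) → Distinguishes w (i , a) (i , b)
    sound (c , refl , s) with c ≟ a | c ≟ b | adj (H i) a c in ac | adj (H i) b c in bc
    ... | yes refl | _        | _     | _     = distinguishes-self (copy-≢ a≢b)
    ... | no _     | yes refl | _     | _     = distinguishes-other (copy-≢ a≢b)
    ... | no _     | no _     | true  | false = adjacent-distinguishes (inner ac) (¬LexAdj-sameCopy bc)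
    ... | no _     | no _     | false | true  = Distinguishes-sym (adjacent-distinguishes (inner bc) (¬LexAdj-sameCopy ac))
    ... | no _     | no _     | true  | true  = contradiction s λ ()
    ... | no _     | no _     | false | false = contradiction s λ ()

    iz : adj G i (proj₁ (GD.neighbour 2≤G connected i)) ≡ true
    iz = proj₂ (GD.neighbour 2≤G connected i)

    same-distance : ∀ {c} → c ≢ a → c ≢ b → adj (H i) a c ≡ adj (H i) b c →
                    ¬ Distinguishes (i , c) (i , a) (i , b)
    same-distance {c} c≢a c≢b same with adj (H i) a c in ac | adj (H i) b c in bc
    ... | true  | true  = equidistant⇒¬distinguishes (IsDist-one (inner ac)) (IsDist-one (inner bc))
    ... | false | false =
      equidistant⇒¬distinguishes (IsDist-commonNeighbour point iz iz (copy-≢ (c≢a ∘ sym)) (¬LexAdj-sameCopy ac))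
                                 (IsDist-commonNeighbour point iz iz (copy-≢ (c≢b ∘ sym)) (¬LexAdj-sameCopy bc))

    complete : ∀ {w} → Distinguishes w (i , a) (i , b) → w ∈ copyOf i separates
    complete {p , c} D with p ≟ i
    ... | no p≢i = contradiction D (twinCopies-¬distinguishes point connected Twins-refl p≢i p≢i a b c)
    ... | yes refl with separates c in s
    ...   | true  = ∈-copyOf⁺ s
    ...   | false =
      let c≢a , rest    = ∨≡false⇒ {eqB c a} s
          c≢b , differ = ∨≡false⇒ {eqB c b} rest
      in contradiction D (same-distance (eqB≡false⇒≢ c≢a) (eqB≡false⇒≢ c≢b) (xor≡false⇒≡ differ))

  trueTwins-distinguishers : ∀ {j l a b} → j ≢ l → Twins G j l → adj G j l ≡ true →
    Distinguishers (j , a) (l , b) ((order (H j) ∸ degree (H j) a) + (order (H l) ∸ degree (H l) b))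
  trueTwins-distinguishers {j} {l} {a} {b} j≢l t jl = record
    { list     = copyOf j (not ∘ adj (H j) a) ++ copyOf l (not ∘ adj (H l) b)
    ; unique   = Unique-++-copies j≢l (copyOf-InCopy j _) (copyOf-InCopy l _) (Unique-copyOf j _) (Unique-copyOf l _)
    ; sound    = ++⁺ (All.tabulate (soundʲ ∘ ∈-copyOf⁻)) (All.tabulate (soundˡ ∘ ∈-copyOf⁻))
    ; complete = complete
    ; size     = trans (length-++ (copyOf j _)) (cong₂ _+_
                   (trans (length-copyOf j _) (countB-not (adj (H j) a)))
                   (trans (length-copyOf l _) (countB-not (adj (H l) b))))
    }
    where
    soundʲ : ∀ {w} → (∃ λ c → w ≡ (j , c) × not (adj (H j) a c) ≡ true) → Distinguishes w (j , a) (l , b)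
    soundʲ (c , refl , ¬ac) with c ≟ a
    ... | yes refl = distinguishes-self (copies-≢ j≢l)
    ... | no _     = Distinguishes-sym (adjacent-distinguishes (outer (adj-sym jl)) (¬LexAdj-sameCopy (not-injective ¬ac)))

    soundˡ : ∀ {w} → (∃ λ c → w ≡ (l , c) × not (adj (H l) b c) ≡ true) → Distinguishes w (j , a) (l , b)
    soundˡ (c , refl , ¬bc) with c ≟ b
    ... | yes refl = distinguishes-other (copies-≢ j≢l)
    ... | no _     = adjacent-distinguishes (outer jl) (¬LexAdj-sameCopy (not-injective ¬bc))

    complete : ∀ {w} → Distinguishes w (j , a) (l , b) →
               w ∈ copyOf j (not ∘ adj (H j) a) ++ copyOf l (not ∘ adj (H l) b)
    complete {p , c} D with p ≟ j | p ≟ l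
    ... | yes refl | _ with adj (H j) a c in ac
    ...   | false = ∈-++⁺ˡ (∈-copyOf⁺ (cong not ac))
    ...   | true  = contradiction D (equidistant⇒¬distinguishes (IsDist-one (inner ac))
                                                               (IsDist-one (outer (adj-sym jl))))
    complete {p , c} D | no _ | yes refl with adj (H l) b c in bc
    ...   | false = ∈-++⁺ʳ (copyOf j _) (∈-copyOf⁺ (cong not bc))
    ...   | true  = contradiction D (equidistant⇒¬distinguishes (IsDist-one (outer jl))
                                                               (IsDist-one (inner bc)))
    complete {p , c} D | no p≢j | no p≢l =
      contradiction D (twinCopies-¬distinguishes point connected t p≢j p≢l a b c)

  nonadjacentTwins-commonNeighbour : ∀ {j l} → Twins G j l → adj G j l ≡ false →
                                     ∃ λ z → adj G j z ≡ true × adj G l z ≡ true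
  nonadjacentTwins-commonNeighbour {j} {l} t ¬jl with GD.neighbour 2≤G connected j
  ... | z , jz with z ≟ l
  ...   | yes refl = contradiction (trans (sym jz) ¬jl) λ ()
  ...   | no z≢l   = z , jz , trans (sym (t z (adj-≢ jz) z≢l)) jz

  falseTwins-distinguishers : ∀ {j l a b} → j ≢ l → Twins G j l → adj G j l ≡ false →
    Distinguishers (j , a) (l , b) (suc (degree (H j) a) + suc (degree (H l) b))
  falseTwins-distinguishers {j} {l} {a} {b} j≢l t ¬jl = record
    { list     = closedNeighbourhood j a ++ closedNeighbourhood l b
    ; unique   = Unique-++-copies j≢l (closedNeighbourhood-InCopy j a) (closedNeighbourhood-InCopy l b)
                                     (Unique-closedNeighbourhood j a) (Unique-closedNeighbourhood l b)
    ; sound    = ++⁺ (distinguishes-self (copies-≢ j≢l) ∷ All.tabulate (soundʲ ∘ ∈-copyOf⁻))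
                     (distinguishes-other (copies-≢ j≢l) ∷ All.tabulate (soundˡ ∘ ∈-copyOf⁻))
    ; complete = complete
    ; size     = trans (length-++ (closedNeighbourhood j a))
                       (cong₂ (λ m n → suc m + suc n) (length-copyOf j _) (length-copyOf l _))
    }
    where
    ¬lj : adj G l j ≡ false
    ¬lj = trans (Graph.sym G l j) ¬jl

    soundʲ : ∀ {w} → (∃ λ c → w ≡ (j , c) × adj (H j) a c ≡ true) → Distinguishes w (j , a) (l , b)
    soundʲ (c , refl , ac) = adjacent-distinguishes (inner ac) (¬LexAdj-copies (j≢l ∘ sym) ¬lj)

    soundˡ : ∀ {w} → (∃ λ c → w ≡ (l , c) × adj (H l) b c ≡ true) → Distinguishes w (j , a) (l , b)
    soundˡ (c , refl , bc) = Distinguishes-sym (adjacent-distinguishes (inner bc) (¬LexAdj-copies j≢l ¬jl))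

    common : ∃ λ z → adj G j z ≡ true × adj G l z ≡ true
    common = nonadjacentTwins-commonNeighbour t ¬jl
    jz : adj G j (proj₁ common) ≡ true
    jz = proj₁ (proj₂ common)
    lz : adj G l (proj₁ common) ≡ true
    lz = proj₂ (proj₂ common)

    complete : ∀ {w} → Distinguishes w (j , a) (l , b) → w ∈ closedNeighbourhood j a ++ closedNeighbourhood l b
    complete {p , c} D with p ≟ j | p ≟ l
    ... | yes refl | _ with c ≟ a | adj (H j) a c in ac
    ...   | yes refl | _     = here refl
    ...   | no _     | true  = there (∈-++⁺ˡ (∈-copyOf⁺ ac))
    ...   | no c≢a   | false = contradiction D (equidistant⇒¬distinguishes
              (IsDist-commonNeighbour point jz jz (copy-≢ (c≢a ∘ sym)) (¬LexAdj-sameCopy ac))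
              (IsDist-commonNeighbour point lz jz (copies-≢ (j≢l ∘ sym)) (¬LexAdj-copies (j≢l ∘ sym) ¬lj)))
    complete {p , c} D | no _ | yes refl with c ≟ b | adj (H l) b c in bc
    ...   | yes refl | _     = ∈-++⁺ʳ (closedNeighbourhood j a) (here refl)
    ...   | no _     | true  = ∈-++⁺ʳ (closedNeighbourhood j a) (there (∈-copyOf⁺ bc))
    ...   | no c≢b   | false = contradiction D (equidistant⇒¬distinguishes
              (IsDist-commonNeighbour point jz lz (copies-≢ j≢l) (¬LexAdj-copies j≢l ¬jl))
              (IsDist-commonNeighbour point lz lz (copy-≢ (c≢b ∘ sym)) (¬LexAdj-sameCopy bc)))
    complete {p , c} D | no p≢j | no p≢l =
      contradiction D (twinCopies-¬distinguishes point connected t p≢j p≢l a b c)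

  nonTwins-distinguishingList : ∀ {i j} → twinRel G i j ≡ false → ∀ a b →
                                ∃ λ z → DistinguishingList (i , a) (j , b) (copyOf z (λ _ → true))
  nonTwins-distinguishingList {i} {j} ¬twins a b with twinRel≡false⇒separated ¬twins
  ... | z , z≢i , z≢j , differ =
    z , Unique-copyOf z _ , All.tabulate (separated ∘ ∈-copyOf⁻)
    where
    separated : ∀ {w} → (∃ λ c → w ≡ (z , c) × true ≡ true) → Distinguishes w (i , a) (j , b)
    separated (c , refl , _) with adj G i z in iz | adj G j z in jz
    ... | true  | false = separating-distinguishes z≢j iz jz
    ... | false | true  = Distinguishes-sym (separating-distinguishes z≢i jz iz)
    ... | true  | true  = contradiction refl differ
    ... | false | false = contradiction refl differ

  κ : ℕ
  κ = 𝒯 G H ⊓ 𝒞fam G H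

  κ≤𝒯vertex : ∀ i → κ ≤ 𝒯vertex G H i
  κ≤𝒯vertex i = ≤-trans (m⊓n≤m (𝒯 G H) _) (𝒯≤𝒯vertex i)

  κ≤𝒞 : ∀ i → κ ≤ 𝒞 (H i)
  κ≤𝒞 i = ≤-trans (m⊓n≤n (𝒯 G H) _) (𝒞fam≤𝒞 i)

  atLeastκ : ∀ {x y n} → Distinguishers x y n → κ ≤ n →
             ∃ λ ws → DistinguishingList x y ws × κ ≤ length ws
  atLeastκ ds κ≤n = list , distinguishingList , ≤-trans κ≤n (≤-reflexive (sym size))
    where open Distinguishers ds

  κ≤trueTwins : ∀ {i j a b} → j ≢ i → Twins G i j → adj G i j ≡ true →
                κ ≤ (order (H i) ∸ degree (H i) a) + (order (H j) ∸ degree (H j) b)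
  κ≤trueTwins {i} {j} {a} {b} j≢i t ij = begin
    κ                                                  ≤⟨ κ≤𝒯vertex i ⟩
    𝒯vertex G H i                                      ≤⟨ 𝒯vertex≤trueTwinCost j≢i t ij ⟩
    (order (H i) ∸ Δ (H i)) + (order (H j) ∸ Δ (H j))  ≤⟨ +-mono-≤ (∸-monoʳ-≤ _ (degree≤Δ (H i) a))
                                                                    (∸-monoʳ-≤ _ (degree≤Δ (H j) b)) ⟩
    (order (H i) ∸ degree (H i) a) + (order (H j) ∸ degree (H j) b) ∎
    where open ≤-Reasoning

  κ≤falseTwins : ∀ {i j a b} → j ≢ i → Twins G i j → adj G i j ≡ false →
                 κ ≤ suc (degree (H i) a) + suc (degree (H j) b)
  κ≤falseTwins {i} {j} {a} {b} j≢i t ¬ij = begin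
    κ                                            ≤⟨ κ≤𝒯vertex i ⟩
    𝒯vertex G H i                                ≤⟨ 𝒯vertex≤falseTwinCost j≢i t ¬ij ⟩
    δ (H i) + δ (H j) + 2                        ≡⟨ +-two≡suc+suc (δ (H i)) _ ⟩
    suc (δ (H i)) + suc (δ (H j))                ≤⟨ +-mono-≤ (s≤s (δ≤degree (H i) a)) (s≤s (δ≤degree (H j) b)) ⟩
    suc (degree (H i) a) + suc (degree (H j) b)  ∎
    where open ≤-Reasoning

  everyPair-distinguishingList : ∀ {x y} → x ≢ y → ∃ λ ws → DistinguishingList x y ws × κ ≤ length ws
  everyPair-distinguishingList {i , a} {j , b} x≢y with i ≟ j
  ... | yes refl = atLeastκ (sameCopy-distinguishers a≢b) (≤-trans (κ≤𝒞 i) (𝒞≤𝒞pair (H i) a≢b))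
    where
    a≢b : a ≢ b
    a≢b refl = x≢y refl
  ... | no i≢j with twinRel G i j in twins
  ...   | false =
    let z , list = nonTwins-distinguishingList twins a b
        κ≤order  = ≤-trans (κ≤𝒞 z) (𝒞≤order (H z) (nontrivial z))
    in _ , list , ≤-trans κ≤order (≤-reflexive (sym (length-wholeCopy z)))
  ...   | true with adj G i j in ij
  ...     | true  = atLeastκ (trueTwins-distinguishers i≢j (twinRel⇒Twins twins) ij)
                             (κ≤trueTwins (i≢j ∘ sym) (twinRel⇒Twins twins) ij)
  ...     | false = atLeastκ (falseTwins-distinguishers i≢j (twinRel⇒Twins twins) ij)
                             (κ≤falseTwins (i≢j ∘ sym) (twinRel⇒Twins twins) ij)

  sameCopy-sparse : 𝒞fam G H ≤ κ → SparselyDistinguishedPair κ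
  sameCopy-sparse 𝒞fam≤κ =
    let i , 𝒞fam≡         = 𝒞fam-attained vertex
        a , b , a≢b , 𝒞≡ = 𝒞-attained (H i) (nontrivial i)
    in Distinguishers.sparselyDistinguished (sameCopy-distinguishers {i} a≢b) (copy-≢ a≢b)
         (≤-trans (≤-reflexive (trans (sym 𝒞≡) (sym 𝒞fam≡))) 𝒞fam≤κ)

  trueTwins-sparse : ∀ {j l} → j ≢ l → Twins G j l → adj G j l ≡ true → trueTwinCost j l ≤ κ →
                     SparselyDistinguishedPair κ
  trueTwins-sparse {j} {l} j≢l t jl cost≤κ =
    let a , Δa = Δ-attained (H j) (point j)
        b , Δb = Δ-attained (H l) (point l)
        size≡cost = cong₂ (λ m n → (order (H j) ∸ m) + (order (H l) ∸ n)) (sym Δa) (sym Δb)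
    in Distinguishers.sparselyDistinguished (trueTwins-distinguishers {a = a} {b} j≢l t jl) (copies-≢ j≢l)
         (≤-trans (≤-reflexive size≡cost) cost≤κ)

  falseTwins-sparse : ∀ {j l} → j ≢ l → Twins G j l → adj G j l ≡ false → falseTwinCost j l ≤ κ →
                      SparselyDistinguishedPair κ
  falseTwins-sparse {j} {l} j≢l t ¬jl cost≤κ =
    let a , δa = δ-attained (H j) (point j)
        b , δb = δ-attained (H l) (point l)
        size≡cost = trans (cong₂ (λ m n → suc m + suc n) (sym δa) (sym δb)) (sym (+-two≡suc+suc (δ (H j)) _))
    in Distinguishers.sparselyDistinguished (falseTwins-distinguishers {a = a} {b} j≢l t ¬jl) (copies-≢ j≢l)
         (≤-trans (≤-reflexive size≡cost) cost≤κ)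

  twinCopies-sparse : ∀ {i} → 𝒯 G H < 𝒞fam G H → κ ≡ 𝒯vertex G H i → 𝒯vertexView i →
                      SparselyDistinguishedPair κ
  twinCopies-sparse {i} 𝒯<𝒞fam κ≡ (singleton value) = contradiction (begin
    𝒞fam G H         ≤⟨ 𝒞fam≤𝒞 i ⟩
    𝒞 (H i)          ≤⟨ 𝒞≤order (H i) (nontrivial i) ⟩
    order (H i)      ≡⟨ sym value ⟩
    𝒯vertex G H i    ≡⟨ sym κ≡ ⟩
    κ                ≤⟨ m⊓n≤m (𝒯 G H) _ ⟩
    𝒯 G H            ∎) (<⇒≱ 𝒯<𝒞fam)
    where open ≤-Reasoning
  twinCopies-sparse _ κ≡ (trueTwins j≢l t jl value) =
    trueTwins-sparse j≢l t jl (≤-reflexive (trans (sym value) (sym κ≡)))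
  twinCopies-sparse _ κ≡ (falseTwins j≢l t ¬jl value) =
    falseTwins-sparse j≢l t ¬jl (≤-reflexive (trans (sym value) (sym κ≡)))

  sparselyDistinguishedPair : SparselyDistinguishedPair κ
  sparselyDistinguishedPair with 𝒞fam G H ≤? 𝒯 G H
  ... | yes 𝒞fam≤𝒯 = sameCopy-sparse (≤-reflexive (sym (m≥n⇒m⊓n≡n 𝒞fam≤𝒯)))
  ... | no 𝒞fam≰𝒯 =
    let 𝒯<𝒞fam = ≰⇒> 𝒞fam≰𝒯
        i , 𝒯≡ = 𝒯-attained vertex
    in twinCopies-sparse 𝒯<𝒞fam (trans (m≤n⇒m⊓n≡m (<⇒≤ 𝒯<𝒞fam)) 𝒯≡) (𝒯vertex-view i)

theorem5 : (G : Graph) → 2 ≤ order G → Metric.Connected (λ x y → adj G x y ≡ true) →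
    (H : Fin (order G) → Graph) → (∀ i → 2 ≤ order (H i)) →
    (k : ℕ) →
    Metric.KMetricDimensional (LexAdj G H) k ⇔ (k ≡ 𝒯 G H ⊓ 𝒞fam G H)
theorem5 G 2≤G connected H nontrivial =
  kMetricDimensional⇔ sparselyDistinguishedPair everyPair-distinguishingList
  where
  open LexProduct G H using (kMetricDimensional⇔)
  open Lexicographic G 2≤G connected H nontrivial using (sparselyDistinguishedPair; everyPair-distinguishingList)
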